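{- Let $A\in I(k,l)$, $w\in a_{k,l}(n)$, and let $x\in\{t_1,\dots,t_k,u_1,\dots,u_l\}$. Let $w'$ be the word obtained from $w$ by deleting all letters that are $A$-greater than $x$. Let $P_A$ and $P'_A$ be the $A$-RSK insertion tableaux of $w$ and $w'$ respectively. Then $P'_A$ is a subtableau of $P_A$, i.e. the diagram of $P'_A$ is contained in the diagram of $P_A$ and $P_A$ has the same entries as $P'_A$ in the cells of $P'_A$.
   Context: Let $t_1,\dots,t_k,u_1,\dots,u_l$ be distinct symbols ("$t$-letters" and "$u$-letters"). A shuffle is a total order $<_A$ with $t_1<_A\cdots<_A t_k$ and $u_1<_A\cdots<_A u_l$; $I(k,l)$ is the set of shuffles. $a_{k,l}(n)$ is the set of words of length $n$ in these letters. $c(i,j)$ is the cell in row $i$, column $j$ (English convention). $A$-RSK insertion of a letter $x$ into a tableau proceeds in steps: initially $x$ is inserted into row 1 if a $t$-letter, into column 1 if a $u$-letter. Inserting a $t$-letter $y$ into row $r$: $y$ bumps the leftmost entry of row $r$ strictly $A$-greater than $y$, or if none, is placed in a new cell at the end of row $r$. Inserting a $u$-letter $y$ into column $c$: $y$ bumps the topmost entry of column $c$ strictly $A$-greater than $y$, or if none, is placed in a new cell at the bottom of column $c$. An entry bumped from $c(i,j)$ is next inserted into row $i+1$ if a $t$-letter, into column $j+1$ if a $u$-letter; insertion ends when a new cell is created. The insertion tableau of a word is obtained by inserting its letters successively into the empty tableau. -}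

module Defs where

open import Data.Nat using (ℕ; zero; suc; _<_; _≤?_; _≟_)
open import Data.Fin as Fin using (Fin)
open import Data.Maybe using (Maybe; just; nothing)
open import Data.List using (List; []; _∷_; filter)
open import Data.Vec using (Vec; toList)
open import Data.Product using (_×_)
open import Data.Bool using (if_then_else_)
open import Relation.Nullary using (¬_; does)
open import Relation.Binary.PropositionalEquality using (_≡_; _≢_)

-- Letters: t-letters t 0 .. t (k-1) and u-letters u 0 .. u (l-1) (0-based).
data Letter (k l : ℕ) : Set where
  t : Fin k → Letter k l
  u : Fin l → Letter k l

-- A shuffle A ∈ I(k,l): a strict total order on the letters, given by an
-- injective rank function into ℕ (x <_A y iff rank x < rank y),
-- with t_1 <_A ... <_A t_k and u_1 <_A ... <_A u_l.
record Shuffle (k l : ℕ) : Set where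
  field
    rank     : Letter k l → ℕ
    rank-inj : ∀ x y → rank x ≡ rank y → x ≡ y
    t-mono   : ∀ i j → i Fin.< j → rank (t i) < rank (t j)
    u-mono   : ∀ i j → i Fin.< j → rank (u i) < rank (u j)
open Shuffle public

_<[_]_ : ∀ {k l} → Letter k l → Shuffle k l → Letter k l → Set
x <[ A ] y = rank A x < rank A y

-- Tableaux: partial fillings of cells c(i,j) (0-based row i, column j).
Tableau : ℕ → ℕ → Set
Tableau k l = ℕ → ℕ → Maybe (Letter k l)

empty : ∀ {k l} → Tableau k l
empty _ _ = nothing

set : ∀ {k l} → Tableau k l → ℕ → ℕ → Letter k l → Tableau k l
set T i j y i' j' =
  if does (i ≟ i') then (if does (j ≟ j') then just y else T i' j') else T i' j'

nextIx : ∀ {k l} → Letter k l → ℕ → ℕ → ℕ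
nextIx (t _) i j = suc i
nextIx (u _) i j = suc j

-- Ins A T r y T' : inserting letter y at index r (a row index if y is a
-- t-letter, a column index if y is a u-letter) into T yields T'.
data Ins {k l : ℕ} (A : Shuffle k l) : Tableau k l → ℕ → Letter k l → Tableau k l → Set where
  rowBump : ∀ {T T'} r (a : Fin k) j z →
    T r j ≡ just z → t a <[ A ] z →
    (∀ j' z' → j' < j → T r j' ≡ just z' → ¬ (t a <[ A ] z')) →
    Ins A (set T r j (t a)) (nextIx z r j) z T' →
    Ins A T r (t a) T'
  rowNew : ∀ {T} r (a : Fin k) j →
    (∀ j' z' → T r j' ≡ just z' → ¬ (t a <[ A ] z')) →
    T r j ≡ nothing → (∀ j' → j' < j → T r j' ≢ nothing) →
    Ins A T r (t a) (set T r j (t a))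
  colBump : ∀ {T T'} c (b : Fin l) i z →
    T i c ≡ just z → u b <[ A ] z →
    (∀ i' z' → i' < i → T i' c ≡ just z' → ¬ (u b <[ A ] z')) →
    Ins A (set T i c (u b)) (nextIx z i c) z T' →
    Ins A T c (u b) T'
  colNew : ∀ {T} c (b : Fin l) i →
    (∀ i' z' → T i' c ≡ just z' → ¬ (u b <[ A ] z')) →
    T i c ≡ nothing → (∀ i' → i' < i → T i' c ≢ nothing) →
    Ins A T c (u b) (set T i c (u b))

-- InsWord A T w T' : inserting the letters of w successively (first letter
-- first) into T, each starting in row 1 / column 1 (index 0), yields T'.
data InsWord {k l : ℕ} (A : Shuffle k l) : Tableau k l → List (Letter k l) → Tableau k l → Set where
  done : ∀ {T} → InsWord A T [] T
  step : ∀ {T T₁ T₂ y ys} → Ins A T 0 y T₁ → InsWord A T₁ ys T₂ → InsWord A T (y ∷ ys) T₂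

InsertionTableau : ∀ {k l} → Shuffle k l → List (Letter k l) → Tableau k l → Set
InsertionTableau A w P = InsWord A empty w P

deleteGreater : ∀ {k l} → Shuffle k l → Letter k l → List (Letter k l) → List (Letter k l)
deleteGreater A x = filter (λ y → rank A y ≤? rank A x)

Subtableau : ∀ {k l} → Tableau k l → Tableau k l → Set
Subtableau P' P = ∀ i j y → P' i j ≡ just y → P i j ≡ just y

{-# OPTIONS --safe #-}
-- P'_A is the part of P_A made of the letters A-smaller than or equal to x.
-- Inserting a letter y >_A x only ever bumps letters >_A x, so it leaves that
-- part unchanged.  Inserting y ≤_A x into P_A and into its part ≤_A x follows
-- the same bumping path: at each step both bump the same entry, until either
-- both create the same new cell, or P_A bumps a letter >_A x out of the cell
-- where the restricted tableau creates its new cell.  Comparing positions along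
-- a line uses that every intermediate tableau is an A-tableau, and insertion
-- preserves that property because a bumped letter settles in the next line at
-- a position weakly before the one it was bumped from.
module Submission where

open import Defs
open import Data.Nat using (ℕ; zero; suc; _<_; _≤_; _≤?_; _≟_)
open import Data.Nat.Properties
  using (<-cmp; <-trans; <-irrefl; ≤-refl; ≤-trans; <-≤-trans; ≤-<-trans; <⇒≤; <⇒≱; <⇒≢; >⇒≢;
         ≮⇒≥; ≰⇒>; n<1+n; m≤n⇒m<n∨m≡n; m<1+n⇒m<n∨m≡n)
open import Data.Vec using (Vec; toList)
open import Data.List using ([]; _∷_)
open import Data.List.Properties using (filter-accept; filter-reject)
open import Data.Maybe using (Maybe; just; nothing)
open import Data.Maybe.Properties using (just-injective)
open import Data.Product using (∃; _×_; _,_; proj₁; proj₂)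
open import Data.Sum using (_⊎_; inj₁; inj₂)
open import Data.Unit using (⊤)
open import Relation.Nullary using (¬_; yes; no; contradiction)
open import Relation.Nullary.Decidable using (dec-true; dec-false)
open import Relation.Binary using (tri<; tri≈; tri>)
open import Relation.Binary.PropositionalEquality
  using (_≡_; _≢_; refl; sym; trans; cong; subst)

≡just⇒≢nothing : ∀ {X : Set} {m : Maybe X} {a : X} → m ≡ just a → m ≢ nothing
≡just⇒≢nothing refl ()

≢nothing⇒≡just : ∀ {X : Set} {m : Maybe X} → m ≢ nothing → ∃ λ a → m ≡ just a
≢nothing⇒≡just {m = just a}  _          = a , refl
≢nothing⇒≡just {m = nothing} m≢nothing = contradiction refl m≢nothing

data SameCell (i j : ℕ) : ℕ → ℕ → Set where
  same  : SameCell i j i j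
  other : ∀ {i′ j′} → (i ≡ i′ → j ≢ j′) → SameCell i j i′ j′

sameCell? : ∀ i j i′ j′ → SameCell i j i′ j′
sameCell? i j i′ j′ with i ≟ i′ | j ≟ j′
... | yes refl | yes refl = same
... | yes _    | no j≢j′  = other λ _ → j≢j′
... | no i≢i′  | _        = other λ i≡i′ → contradiction i≡i′ i≢i′

set-same : ∀ {k l} (T : Tableau k l) i j y → set T i j y i j ≡ just y
set-same T i j y rewrite dec-true (i ≟ i) refl | dec-true (j ≟ j) refl = refl

set-other : ∀ {k l} (T : Tableau k l) {i j i′ j′} y → (i ≡ i′ → j ≢ j′) →
  set T i j y i′ j′ ≡ T i′ j′
set-other T {i} {j} {i′} {j′} y ne with i ≟ i′
... | no i≢i′  rewrite dec-false (i ≟ i′) i≢i′ = refl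
... | yes i≡i′ rewrite dec-true (i ≟ i′) i≡i′ | dec-false (j ≟ j′) (ne i≡i′) = refl

-- Rows and columns are handled uniformly: line n of direction row is row n,
-- of direction col it is column n, and p is the position along the line.
data Dir : Set where
  row col : Dir

flip : Dir → Dir
flip row = col
flip col = row

dir : ∀ {k l} → Letter k l → Dir
dir (t _) = row
dir (u _) = col

module _ {k l : ℕ} where

  at : Dir → Tableau k l → ℕ → ℕ → Maybe (Letter k l)
  at row T n p = T n p
  at col T n p = T p n

  setAt : Dir → Tableau k l → ℕ → ℕ → Letter k l → Tableau k l
  setAt row T n p = set T n p
  setAt col T n p = set T p n

  nextAt : Dir → Letter k l → ℕ → ℕ → ℕ
  nextAt row z n p = nextIx z n p
  nextAt col z n p = nextIx z p n

  at-flip : ∀ d T n p → at (flip d) T p n ≡ at d T n p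
  at-flip row T n p = refl
  at-flip col T n p = refl

  at-setAt-same : ∀ d T n p y → at d (setAt d T n p y) n p ≡ just y
  at-setAt-same row T n p y = set-same T n p y
  at-setAt-same col T n p y = set-same T p n y

  at-setAt-other : ∀ d T {n p n′ p′} y → (n ≡ n′ → p ≢ p′) →
    at d (setAt d T n p y) n′ p′ ≡ at d T n′ p′
  at-setAt-other row T y ne = set-other T y ne
  at-setAt-other col T y ne = set-other T y λ p≡p′ n≡n′ → ne n≡n′ p≡p′

  at-flip-setAt-other : ∀ d T {n p n′ p′} y → (n ≡ n′ → p ≢ p′) →
    at (flip d) (setAt d T n p y) p′ n′ ≡ at (flip d) T p′ n′
  at-flip-setAt-other row T y ne = set-other T y ne
  at-flip-setAt-other col T y ne = set-other T y λ p≡p′ n≡n′ → ne n≡n′ p≡p′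

  FilledBefore : Dir → Tableau k l → ℕ → ℕ → Set
  FilledBefore d T n p = ∀ q → q < p → at d T n q ≢ nothing

module Insertion {k l : ℕ} (A : Shuffle k l) where

  _≺_ : Letter k l → Letter k l → Set
  a ≺ b = a <[ A ] b

  _≼_ : Letter k l → Letter k l → Set
  a ≼ b = rank A a ≤ rank A b

  NoneExceeds : Dir → Tableau k l → ℕ → Letter k l → Set
  NoneExceeds d T n y = ∀ q c → at d T n q ≡ just c → ¬ y ≺ c

  NoneExceedsBefore : Dir → Tableau k l → ℕ → ℕ → Letter k l → Set
  NoneExceedsBefore d T n p y = ∀ q c → q < p → at d T n q ≡ just c → ¬ y ≺ c

  -- The order along the lines of an A-tableau (t-letters may repeat in rows,
  -- u-letters in columns).
  _≤[_]_ : Letter k l → Dir → Letter k l → Set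
  a ≤[ d ] b = a ≺ b ⊎ (a ≡ b × dir a ≡ d)

  ≤[]⇒≼ : ∀ {a b d} → a ≤[ d ] b → a ≼ b
  ≤[]⇒≼ (inj₁ a≺b)         = <⇒≤ a≺b
  ≤[]⇒≼ (inj₂ (refl , _)) = ≤-refl

  ≤[]-≺-trans : ∀ {a b c d} → a ≤[ d ] b → b ≺ c → a ≺ c
  ≤[]-≺-trans a≤b = ≤-<-trans (≤[]⇒≼ a≤b)

  ≺-≤[]-trans : ∀ {a b c d} → a ≺ b → b ≤[ d ] c → a ≺ c
  ≺-≤[]-trans a≺b b≤c = <-≤-trans a≺b (≤[]⇒≼ b≤c)

  ≤[flip]⇒≺ : ∀ {a b} → a ≤[ flip (dir a) ] b → a ≺ b
  ≤[flip]⇒≺         (inj₁ a≺b)     = a≺b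
  ≤[flip]⇒≺ {t _} (inj₂ (_ , ()))
  ≤[flip]⇒≺ {u _} (inj₂ (_ , ()))

  ⊀⇒≤[] : ∀ {a b} → ¬ b ≺ a → a ≤[ dir b ] b
  ⊀⇒≤[] {a} {b} b⊀a with m≤n⇒m<n∨m≡n (≮⇒≥ b⊀a)
  ... | inj₁ a≺b = inj₁ a≺b
  ... | inj₂ a≡b with rank-inj A a b a≡b
  ...   | refl = inj₂ (refl , refl)

  record Lines (d : Dir) (T : Tableau k l) : Set where
    field
      closed : ∀ {n p q} → p < q → at d T n q ≢ nothing → at d T n p ≢ nothing
      sorted : ∀ {n p q a b} → p < q → at d T n p ≡ just a → at d T n q ≡ just b → a ≤[ d ] b
  open Lines

  entry⇒filledBefore : ∀ {d T n p z} → Lines d T → at d T n p ≡ just z → FilledBefore d T n p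
  entry⇒filledBefore lines ez q q<p = closed lines q<p (≡just⇒≢nothing ez)

  IsTableau : Tableau k l → Set
  IsTableau T = ∀ d → Lines d T

  empty-tableau : IsTableau empty
  empty-tableau row = record { closed = λ _ filled → contradiction refl filled ; sorted = λ _ () }
  empty-tableau col = record { closed = λ _ filled → contradiction refl filled ; sorted = λ _ () }

  record Fits (d : Dir) (T : Tableau k l) (n p : ℕ) (y : Letter k l) : Set where
    field
      filled-before : FilledBefore d T n p
      before-≤ : ∀ {q c} → q < p → at d T n q ≡ just c → c ≤[ d ] y
      after-≥ : ∀ {q c} → p < q → at d T n q ≡ just c → y ≤[ d ] c

  setAt-lines : ∀ {d T n p y} → Lines d T → Fits d T n p y → Lines d (setAt d T n p y)
  setAt-lines {d} {T} {n} {p} {y} lines fits = record { closed = closed′ ; sorted = sorted′ }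
    where
    open Fits fits
    S = setAt d T n p y

    closed′ : ∀ {n′ q r} → q < r → at d S n′ r ≢ nothing → at d S n′ q ≢ nothing
    closed′ {n′} {q} {r} q<r r-filled with sameCell? n p n′ q | sameCell? n p n′ r
    ... | same     | _        = ≡just⇒≢nothing (at-setAt-same d T n p y)
    ... | other q≠ | same     rewrite at-setAt-other d T y q≠ = filled-before _ q<r
    ... | other q≠ | other r≠ rewrite at-setAt-other d T y q≠ =
      closed lines q<r λ e → r-filled (trans (at-setAt-other d T y r≠) e)

    sorted′ : ∀ {n′ q r a b} → q < r → at d S n′ q ≡ just a → at d S n′ r ≡ just b → a ≤[ d ] b
    sorted′ {n′} {q} {r} q<r ea eb with sameCell? n p n′ q | sameCell? n p n′ r
    ... | same     | same     = contradiction q<r (<-irrefl refl)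
    ... | same     | other r≠ with trans (sym (at-setAt-same d T n p y)) ea
    ...   | refl = after-≥ q<r (trans (sym (at-setAt-other d T y r≠)) eb)
    sorted′ q<r ea eb | other q≠ | same with trans (sym (at-setAt-same d T n p y)) eb
    ...   | refl = before-≤ q<r (trans (sym (at-setAt-other d T y q≠)) ea)
    sorted′ q<r ea eb | other q≠ | other r≠ =
      sorted lines q<r (trans (sym (at-setAt-other d T y q≠)) ea) (trans (sym (at-setAt-other d T y r≠)) eb)

  setAt-tableau : ∀ d {T n p y} → IsTableau T → Fits d T n p y → Fits (flip d) T p n y →
    IsTableau (setAt d T n p y)
  setAt-tableau row tb along across row = setAt-lines (tb row) along
  setAt-tableau row tb along across col = setAt-lines (tb col) across
  setAt-tableau col tb along across row = setAt-lines (tb row) across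
  setAt-tableau col tb along across col = setAt-lines (tb col) along

  -- The invariant of a bumping path: the letter y entering line suc n was bumped
  -- from position pos of line n.  It forces y to settle in line suc n at a
  -- position ≤ pos, so that the entry of line n at that position is smaller than y.
  record BumpedFrom (d : Dir) (T : Tableau k l) (n : ℕ) (y : Letter k l) : Set where
    field
      pos : ℕ
      before-≺ : ∀ {q} → q ≤ pos → ∃ λ c → at d T n q ≡ just c × c ≺ y
      next-≻ : ∀ {b} → at d T (suc n) pos ≡ just b → y ≺ b

  Insertable : Dir → Tableau k l → ℕ → Letter k l → Set
  Insertable _ _ zero    _ = ⊤
  Insertable d T (suc n) y = BumpedFrom d T n y

  settles-under : ∀ d {T n p y} → IsTableau T → Insertable d T n y →
    FilledBefore d T n p → NoneExceedsBefore d T n p y →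
    ∀ {m} → m < n → ∃ λ c → at (flip d) T p m ≡ just c × c ≺ y
  settles-under d {n = suc n} {p} {y} tb bumped filled left {m} m<1+n = under (m<1+n⇒m<n∨m≡n m<1+n)
    where
    open BumpedFrom bumped

    p≤pos : p ≤ pos
    p≤pos = ≮⇒≥ λ pos<p →
      let (c , e) = ≢nothing⇒≡just (filled pos pos<p) in left pos c pos<p e (next-≻ e)

    above : ∃ λ c → at (flip d) _ p n ≡ just c × c ≺ y
    above = let (c , e , c≺y) = before-≺ p≤pos in c , trans (at-flip d _ n p) e , c≺y

    under : m < n ⊎ m ≡ n → ∃ λ c → at (flip d) _ p m ≡ just c × c ≺ y
    under (inj₂ refl) = above
    under (inj₁ m<n) =
      let (c₀ , e₀ , c₀≺y) = above
          (c , e) = ≢nothing⇒≡just (closed (tb (flip d)) m<n (≡just⇒≢nothing e₀))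
      in c , e , ≤[]-≺-trans (sorted (tb (flip d)) m<n e e₀) c₀≺y

  place-tableau : ∀ d {T n p y} → dir y ≡ d → IsTableau T → Insertable d T n y →
    FilledBefore d T n p → NoneExceedsBefore d T n p y →
    (∀ q c → p < q → at d T n q ≡ just c → y ≤[ d ] c) →
    (∀ m c → n < m → at (flip d) T p m ≡ just c → y ≤[ flip d ] c) →
    IsTableau (setAt d T n p y)
  place-tableau d {T} {n} {p} {y} refl tb ok filled left after under =
    setAt-tableau d tb along across
    where
    along : Fits d T n p y
    along = record
      { filled-before = filled
      ; before-≤ = λ q<p e → ⊀⇒≤[] (left _ _ q<p e)
      ; after-≥ = after _ _
      }
    across : Fits (flip d) T p n y
    across = record
      { filled-before = λ _ m<n → ≡just⇒≢nothing (proj₁ (proj₂ (settles-under d tb ok filled left m<n)))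
      ; before-≤ = λ m<n e →
          let (c , e′ , c≺y) = settles-under d tb ok filled left m<n
          in inj₁ (subst (_≺ y) (just-injective (trans (sym e′) e)) c≺y)
      ; after-≥ = under _ _
      }

  bump-tableau : ∀ d {T n p y z} → dir y ≡ d → IsTableau T → Insertable d T n y →
    at d T n p ≡ just z → y ≺ z → NoneExceedsBefore d T n p y → IsTableau (setAt d T n p y)
  bump-tableau d {T} {n} {p} dy tb ok ez y≺z left =
    place-tableau d dy tb ok (entry⇒filledBefore (tb d) ez) left
      (λ q c p<q e → inj₁ (≺-≤[]-trans y≺z (sorted (tb d) p<q ez e)))
      (λ m c n<m e → inj₁ (≺-≤[]-trans y≺z (sorted (tb (flip d)) n<m (trans (at-flip d T n p) ez) e)))

  new-tableau : ∀ d {T n p y} → dir y ≡ d → IsTableau T → Insertable d T n y →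
    NoneExceeds d T n y → at d T n p ≡ nothing → FilledBefore d T n p → IsTableau (setAt d T n p y)
  new-tableau d {T} {n} {p} dy tb ok none vacant filled =
    place-tableau d dy tb ok filled (λ q c _ → none q c)
      (λ q c p<q e → contradiction vacant (closed (tb d) p<q (≡just⇒≢nothing e)))
      (λ m c n<m e → contradiction (trans (at-flip d T n p) vacant) (closed (tb (flip d)) n<m (≡just⇒≢nothing e)))

  bumped-along : ∀ d {T n p y z} → dir z ≡ d → IsTableau T →
    at d T n p ≡ just z → y ≺ z → NoneExceedsBefore d T n p y → BumpedFrom d (setAt d T n p y) n z
  bumped-along d {T} {n} {p} {y} {z} refl tb ez y≺z left = record { pos = p ; before-≺ = before ; next-≻ = next }
    where
    before : ∀ {q} → q ≤ p → ∃ λ c → at d (setAt d T n p y) n q ≡ just c × c ≺ z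
    before {q} q≤p with m≤n⇒m<n∨m≡n q≤p
    ... | inj₂ refl = y , at-setAt-same d T n p y , y≺z
    ... | inj₁ q<p =
      let (c , e) = ≢nothing⇒≡just (entry⇒filledBefore (tb d) ez q q<p)
      in c , trans (at-setAt-other d T y λ _ → >⇒≢ q<p) e , ≤-<-trans (≮⇒≥ (left q c q<p e)) y≺z

    next : ∀ {b} → at d (setAt d T n p y) (suc n) p ≡ just b → z ≺ b
    next e = ≤[flip]⇒≺ (sorted (tb (flip d)) (n<1+n n) (trans (at-flip d T n p) ez)
      (trans (at-flip d T (suc n) p) (trans (sym (at-setAt-other d T y λ n≡1+n _ → <⇒≢ (n<1+n n) n≡1+n)) e)))

  bumped-across : ∀ d {T n p y z} → d ≡ flip (dir z) → IsTableau T → Insertable d T n y →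
    at d T n p ≡ just z → y ≺ z → NoneExceedsBefore d T n p y → BumpedFrom (flip d) (setAt d T n p y) p z
  bumped-across d {T} {n} {p} {y} {z} refl tb ok ez y≺z left = record { pos = n ; before-≺ = before ; next-≻ = next }
    where
    S = setAt d T n p y

    before : ∀ {m} → m ≤ n → ∃ λ c → at (flip d) S p m ≡ just c × c ≺ z
    before {m} m≤n with m≤n⇒m<n∨m≡n m≤n
    ... | inj₂ refl = y , trans (at-flip d S n p) (at-setAt-same d T n p y) , y≺z
    ... | inj₁ m<n =
      let (c , e , c≺y) = settles-under d tb ok (entry⇒filledBefore (tb d) ez) left m<n
      in c , trans (at-flip-setAt-other d T y λ n≡m → contradiction (sym n≡m) (<⇒≢ m<n)) e , <-trans c≺y y≺z

    next : ∀ {b} → at (flip d) S (suc p) n ≡ just b → z ≺ b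
    next e = ≤[flip]⇒≺ (sorted (tb d) (n<1+n p) ez (trans (sym (at-flip d T n (suc p)))
      (trans (sym (at-flip-setAt-other d T y λ _ p≡1+p → <⇒≢ (n<1+n p) p≡1+p)) e)))

  bumped : ∀ d {T n p y z} → IsTableau T → Insertable d T n y →
    at d T n p ≡ just z → y ≺ z → NoneExceedsBefore d T n p y →
    Insertable (dir z) (setAt d T n p y) (nextAt d z n p) z
  bumped row {z = t _} tb _  = bumped-along row refl tb
  bumped row {z = u _} tb ok = bumped-across row refl tb ok
  bumped col {z = t _} tb ok = bumped-across col refl tb ok
  bumped col {z = u _} tb _  = bumped-along col refl tb

  ins-tableau : ∀ {T r y T′} → IsTableau T → Insertable (dir y) T r y → Ins A T r y T′ → IsTableau T′
  ins-tableau tb ok (rowBump _ _ _ _ ez y≺z left ins) =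
    ins-tableau (bump-tableau row refl tb ok ez y≺z left) (bumped row tb ok ez y≺z left) ins
  ins-tableau tb ok (rowNew _ _ _ none vacant filled) = new-tableau row refl tb ok none vacant filled
  ins-tableau tb ok (colBump _ _ _ _ ez y≺z left ins) =
    ins-tableau (bump-tableau col refl tb ok ez y≺z left) (bumped col tb ok ez y≺z left) ins
  ins-tableau tb ok (colNew _ _ _ none vacant filled) = new-tableau col refl tb ok none vacant filled

  module Restriction (x : Letter k l) where

    keep : Maybe (Letter k l) → Maybe (Letter k l)
    keep nothing = nothing
    keep (just a) with rank A a ≤? rank A x
    ... | yes _ = just a
    ... | no _  = nothing

    keep-≼ : ∀ {a} → a ≼ x → keep (just a) ≡ just a
    keep-≼ {a} a≼x with rank A a ≤? rank A x
    ... | yes _   = refl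
    ... | no a⋠x = contradiction a≼x a⋠x

    keep-≻ : ∀ {a} → x ≺ a → keep (just a) ≡ nothing
    keep-≻ {a} x≺a with rank A a ≤? rank A x
    ... | yes a≼x = contradiction a≼x (<⇒≱ x≺a)
    ... | no _    = refl

    keep≡just : ∀ {m a} → keep m ≡ just a → m ≡ just a × a ≼ x
    keep≡just {just b} e with rank A b ≤? rank A x
    keep≡just {just b} refl | yes b≼x = refl , b≼x
    keep≡just {just b} ()   | no _

    record IsRestriction (T′ T : Tableau k l) : Set where
      constructor restriction
      field restricts : ∀ i j → T′ i j ≡ keep (T i j)
    open IsRestriction

    unrestrict : ∀ {T′ T i j a} → IsRestriction T′ T → T′ i j ≡ just a → T i j ≡ just a × a ≼ x
    unrestrict {i = i} {j} rel e = keep≡just (trans (sym (restricts rel i j)) e)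

    unrestrict-at : ∀ {T′ T} d {n q a} → IsRestriction T′ T → at d T′ n q ≡ just a → at d T n q ≡ just a × a ≼ x
    unrestrict-at row = unrestrict
    unrestrict-at col = unrestrict

    restrict-at : ∀ {T′ T} d {n q m} → IsRestriction T′ T → at d T n q ≡ m → at d T′ n q ≡ keep m
    restrict-at row {n} {q} rel e = trans (restricts rel n q) (cong keep e)
    restrict-at col {n} {q} rel e = trans (restricts rel q n) (cong keep e)

    set-restriction : ∀ {T′ T} i j {y} → IsRestriction T′ T → y ≼ x → IsRestriction (set T′ i j y) (set T i j y)
    set-restriction {T′} {T} i j {y} rel y≼x = restriction restricts′
      where
      restricts′ : ∀ i′ j′ → set T′ i j y i′ j′ ≡ keep (set T i j y i′ j′)
      restricts′ i′ j′ with sameCell? i j i′ j′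
      ... | same = trans (set-same T′ i j y) (sym (trans (cong keep (set-same T i j y)) (keep-≼ y≼x)))
      ... | other ne = trans (set-other T′ y ne) (trans (restricts rel i′ j′) (cong keep (sym (set-other T y ne))))

    set-discarded : ∀ T i j {y} → x ≺ y → keep (T i j) ≡ nothing →
      ∀ i′ j′ → keep (set T i j y i′ j′) ≡ keep (T i′ j′)
    set-discarded T i j {y} x≺y discarded i′ j′ with sameCell? i j i′ j′
    ... | same = trans (cong keep (set-same T i j y)) (trans (keep-≻ x≺y) (sym discarded))
    ... | other ne = cong keep (set-other T y ne)

    ins-above : ∀ {T r y T₁} → x ≺ y → Ins A T r y T₁ → ∀ i j → keep (T₁ i j) ≡ keep (T i j)
    ins-above {T} x≺y (rowBump r _ j _ ez y≺z _ ins) i′ j′ =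
      trans (ins-above x≺z ins i′ j′) (set-discarded T r j x≺y (trans (cong keep ez) (keep-≻ x≺z)) i′ j′)
      where x≺z = <-trans x≺y y≺z
    ins-above {T} x≺y (rowNew r _ j _ vacant _) = set-discarded T r j x≺y (cong keep vacant)
    ins-above {T} x≺y (colBump c _ i _ ez y≺z _ ins) i′ j′ =
      trans (ins-above x≺z ins i′ j′) (set-discarded T i c x≺y (trans (cong keep ez) (keep-≻ x≺z)) i′ j′)
      where x≺z = <-trans x≺y y≺z
    ins-above {T} x≺y (colNew c _ i _ vacant _) = set-discarded T i c x≺y (cong keep vacant)

    restriction-above : ∀ {T′ T r y T₁} → IsRestriction T′ T → x ≺ y → Ins A T r y T₁ → IsRestriction T′ T₁
    restriction-above rel x≺y ins = restriction λ i j → trans (restricts rel i j) (sym (ins-above x≺y ins i j))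

    kept-before : ∀ {T′ T} d {n q y c} → IsRestriction T′ T → y ≼ x →
      at d T n q ≡ just c → ¬ y ≺ c → at d T′ n q ≢ nothing
    kept-before d rel y≼x e y⊀c = ≡just⇒≢nothing (trans (restrict-at d rel e) (keep-≼ (≤-trans (≮⇒≥ y⊀c) y≼x)))

    bump-bump : ∀ d {T′ T n p p′ y z z′} → Lines d T → IsRestriction T′ T →
      at d T n p ≡ just z → y ≺ z → NoneExceedsBefore d T n p y →
      at d T′ n p′ ≡ just z′ → y ≺ z′ → NoneExceedsBefore d T′ n p′ y → p ≡ p′ × z ≡ z′
    bump-bump d {p = p} {p′} lines rel ez y≺z left ez′ y≺z′ left′
      with unrestrict-at d rel ez′ | <-cmp p p′
    ... | ez′ᵀ , z′≼x | tri< p<p′ _ _ =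
      contradiction y≺z (left′ p _ p<p′ (trans (restrict-at d rel ez)
        (keep-≼ (≤-trans (≤[]⇒≼ (sorted lines p<p′ ez ez′ᵀ)) z′≼x))))
    ... | ez′ᵀ , _ | tri≈ _ refl _ = refl , just-injective (trans (sym ez) ez′ᵀ)
    ... | ez′ᵀ , _ | tri> _ _ p′<p = contradiction y≺z′ (left p′ _ p′<p ez′ᵀ)

    bump-new : ∀ d {T′ T n p p′ y z} → Lines d T → IsRestriction T′ T → y ≼ x →
      at d T n p ≡ just z → y ≺ z → NoneExceedsBefore d T n p y →
      NoneExceeds d T′ n y → at d T′ n p′ ≡ nothing → FilledBefore d T′ n p′ → x ≺ z × p ≡ p′
    bump-new d {p = p} {p′} {z = z} lines rel y≼x ez y≺z left none′ vacant′ filled′ = x≺z , p≡p′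
      where
      x≺z : x ≺ z
      x≺z = ≰⇒> λ z≼x → none′ p z (trans (restrict-at d rel ez) (keep-≼ z≼x)) y≺z

      p≡p′ : p ≡ p′
      p≡p′ with <-cmp p p′
      ... | tri< p<p′ _ _ = contradiction (trans (restrict-at d rel ez) (keep-≻ x≺z)) (filled′ p p<p′)
      ... | tri≈ _ p≡p′ _ = p≡p′
      ... | tri> _ _ p′<p =
        let (c , e) = ≢nothing⇒≡just (entry⇒filledBefore lines ez p′ p′<p)
        in contradiction vacant′ (kept-before d rel y≼x e (left p′ c p′<p e))

    new-new : ∀ d {T′ T n p p′ y} → IsRestriction T′ T → y ≼ x →
      NoneExceeds d T n y → at d T n p ≡ nothing → FilledBefore d T n p →
      at d T′ n p′ ≡ nothing → FilledBefore d T′ n p′ → p ≡ p′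
    new-new d {p = p} {p′} rel y≼x none vacant filled vacant′ filled′ with <-cmp p p′
    ... | tri< p<p′ _ _ = contradiction (restrict-at d rel vacant) (filled′ p p<p′)
    ... | tri≈ _ p≡p′ _ = p≡p′
    ... | tri> _ _ p′<p =
      let (c , e) = ≢nothing⇒≡just (filled p′ p′<p)
      in contradiction vacant′ (kept-before d rel y≼x e (none p′ c e))

    ins-restriction : ∀ {T′ T r y T₁′ T₁} → IsTableau T → Insertable (dir y) T r y → y ≼ x →
      IsRestriction T′ T → Ins A T r y T₁ → Ins A T′ r y T₁′ → IsRestriction T₁′ T₁
    ins-restriction tb ok y≼x rel (rowBump r _ j _ ez y≺z left ins) (rowBump _ _ _ _ ez′ y≺z′ left′ ins′)
      with bump-bump row (tb row) rel ez y≺z left ez′ y≺z′ left′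
    ... | refl , refl =
      ins-restriction (bump-tableau row refl tb ok ez y≺z left) (bumped row tb ok ez y≺z left)
        (proj₂ (unrestrict rel ez′)) (set-restriction r j rel y≼x) ins ins′
    ins-restriction tb _ y≼x rel (rowBump r _ j _ ez y≺z left ins) (rowNew _ _ _ none′ vacant′ filled′)
      with bump-new row (tb row) rel y≼x ez y≺z left none′ vacant′ filled′
    ... | x≺z , refl = restriction-above (set-restriction r j rel y≼x) x≺z ins
    ins-restriction _ _ _ rel (rowNew _ _ _ none _ _) (rowBump _ _ _ _ ez′ y≺z′ _ _) =
      contradiction y≺z′ (none _ _ (proj₁ (unrestrict rel ez′)))
    ins-restriction _ _ y≼x rel (rowNew r _ j none vacant filled) (rowNew _ _ _ _ vacant′ filled′)
      with new-new row rel y≼x none vacant filled vacant′ filled′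
    ... | refl = set-restriction r j rel y≼x
    ins-restriction tb ok y≼x rel (colBump c _ i _ ez y≺z left ins) (colBump _ _ _ _ ez′ y≺z′ left′ ins′)
      with bump-bump col (tb col) rel ez y≺z left ez′ y≺z′ left′
    ... | refl , refl =
      ins-restriction (bump-tableau col refl tb ok ez y≺z left) (bumped col tb ok ez y≺z left)
        (proj₂ (unrestrict rel ez′)) (set-restriction i c rel y≼x) ins ins′
    ins-restriction tb _ y≼x rel (colBump c _ i _ ez y≺z left ins) (colNew _ _ _ none′ vacant′ filled′)
      with bump-new col (tb col) rel y≼x ez y≺z left none′ vacant′ filled′
    ... | x≺z , refl = restriction-above (set-restriction i c rel y≼x) x≺z ins
    ins-restriction _ _ _ rel (colNew _ _ _ none _ _) (colBump _ _ _ _ ez′ y≺z′ _ _) =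
      contradiction y≺z′ (none _ _ (proj₁ (unrestrict rel ez′)))
    ins-restriction _ _ y≼x rel (colNew c _ i none vacant filled) (colNew _ _ _ _ vacant′ filled′)
      with new-new col rel y≼x none vacant filled vacant′ filled′
    ... | refl = set-restriction i c rel y≼x

    insWord-restriction : ∀ {T′ T P′ P} w → IsTableau T → IsRestriction T′ T →
      InsWord A T w P → InsWord A T′ (deleteGreater A x w) P′ → IsRestriction P′ P
    insWord-restriction [] tb rel done done = rel
    insWord-restriction {T′} {P′ = P′} (y ∷ ys) tb rel (step ins insw) insw′ with rank A y ≤? rank A x
    ... | yes y≼x with subst (λ w → InsWord A T′ w P′) (filter-accept (λ a → rank A a ≤? rank A x) y≼x) insw′
    ...   | step ins′ insw″ =
      insWord-restriction ys (ins-tableau tb _ ins) (ins-restriction tb _ y≼x rel ins ins′) insw insw″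
    insWord-restriction {T′} {P′ = P′} (y ∷ ys) tb rel (step ins insw) insw′ | no y⋠x =
      insWord-restriction ys (ins-tableau tb _ ins) (restriction-above rel (≰⇒> y⋠x) ins) insw
        (subst (λ w → InsWord A T′ w P′) (filter-reject (λ a → rank A a ≤? rank A x) y⋠x) insw′)

lemma2p6 : (k l : ℕ) (A : Shuffle k l) (n : ℕ) (w : Vec (Letter k l) n) (x : Letter k l)
    (P P' : Tableau k l) →
    InsertionTableau A (toList w) P →
    InsertionTableau A (deleteGreater A x (toList w)) P' →
    Subtableau P' P
lemma2p6 k l A n w x P P' ins ins′ i j y e = proj₁ (unrestrict P′-restricts-P e)
  where
  open Insertion A
  open Restriction x

  P′-restricts-P : IsRestriction P' P
  P′-restricts-P = insWord-restriction (toList w) empty-tableau (restriction λ _ _ → refl) ins ins′
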